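{- A permutation $\pi$ has tier $t(\pi)>0$ (that is, $\pi$ cannot be sorted in a single pass through the stack) if and only if $\pi$ contains a separated pair.
   Context: Multi-pass stack sorting: in a pass, the entries of the current input are pushed one at a time, in order, onto a stack; whenever the top of the stack is the smallest value not yet output, it is popped to the output (repeatedly, as long as this holds); entries are never popped otherwise. When all input entries have been pushed and no pop is possible, if the stack is nonempty the remaining entries are returned to the input in their original relative order and a new pass begins. The tier $t(\pi)$ is one less than the minimum number of passes needed to output $1,2,\dots,n$. For $1\le i\le n-1$, $(i+1,i)$ is a separated pair of $\pi$ if $\pi$ contains a subsequence $(i+1,k,i)$ (in this order of positions) with $k>i+1$. -}

module Defs where

open import Data.Nat using (ℕ; zero; suc; _∸_; _≤_; _<_; _≟_)
open import Data.List using (List; []; _∷_; _++_; reverse; length; map; upTo)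
open import Data.Product using (_×_; _,_; ∃-syntax)
open import Relation.Nullary using (yes; no)
open import Data.List.Relation.Binary.Permutation.Propositional using (_↭_)
open import Data.List.Relation.Binary.Sublist.Propositional using (_⊆_)

-- A permutation of [n] = {1,…,n}, written in one-line notation as a list.
IsPermutation : ℕ → List ℕ → Set
IsPermutation n π = π ↭ map suc (upTo n)

-- Stack is a list with its top at the head.
-- popAll m s : repeatedly pop while the top equals m (the smallest value not
-- yet output); returns the new "next value" and the new stack.
popAll : ℕ → List ℕ → ℕ × List ℕ
popAll m []      = m , []
popAll m (y ∷ s) with y ≟ m
... | yes _ = popAll (suc m) s
... | no  _ = m , (y ∷ s)

-- Returns the next value to output and the new input, which is the remaining
-- stack contents in their original relative order (bottom of stack first).
passFrom : ℕ → List ℕ → List ℕ → ℕ × List ℕ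
passFrom m []       s = m , reverse s
passFrom m (x ∷ xs) s with popAll m (x ∷ s)
... | m' , s' = passFrom m' xs s'

pass : ℕ → List ℕ → ℕ × List ℕ
pass m xs = passFrom m xs []

passesWith : ℕ → ℕ → List ℕ → ℕ
passesWith _        m []       = 0
passesWith zero     m (_ ∷ _)  = 0
passesWith (suc f)  m (x ∷ xs) with pass m (x ∷ xs)
... | m' , rest = suc (passesWith f m' rest)

-- Each pass outputs at least the smallest remaining value, so
-- length π passes always suffice and the fuel is never exhausted.
passes : List ℕ → ℕ
passes π = passesWith (length π) 1 π

tier : List ℕ → ℕ
tier π = passes π ∸ 1

IsSeparatedPair : ℕ → List ℕ → ℕ → Set
IsSeparatedPair n π i =
  1 ≤ i × i ≤ n ∸ 1 ×
  ∃[ k ] (suc i < k × (suc i ∷ k ∷ i ∷ []) ⊆ π)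

HasSeparatedPair : ℕ → List ℕ → Set
HasSeparatedPair n π = ∃[ i ] IsSeparatedPair n π i

-- In a pass whose next value to output is m, the entries not yet output,
-- read as the stack from bottom to top followed by the unread input, are
-- exactly the entries of π that are ≥ m, in their original order.
-- If the stack stays decreasing from bottom to top, the pass sorts π: at
-- the end the top is the smallest remaining value, which would have been
-- popped.  The first time an entry x is pushed onto a smaller top y, we
-- have y > m, so y − 1 is not yet output; it is neither in the stack nor x,
-- hence it comes later in the input, and (y, x, y − 1) is a separated pair.
-- Conversely a separated pair (i+1, k, i) survives as a triple of the
-- remaining entries until i is popped; by then i+1 and k are in the stack
-- with k above i+1, and an entry above a smaller one is never popped, so
-- the pass ends with a nonempty stack.
module Submission where

open import Defs
open import Data.Nat using (ℕ; zero; suc; _<_; _≤_; z≤n; s≤s)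
open import Data.Nat.Properties
open import Data.Maybe using (just)
open import Data.Maybe.Properties using (just-injective)
open import Data.List using (List; []; _∷_; _++_; _ʳ++_; reverse; length; head)
open import Data.List.Properties using (ʳ++-defn; reverse-involutive)
open import Data.List.Membership.Propositional using (_∈_)
open import Data.List.Membership.Propositional.Properties using (∈-map⁺; ∈-map⁻; ∈-upTo⁺; ∈-upTo⁻)
open import Data.List.Relation.Unary.Any using (here; there)
open import Data.List.Relation.Unary.Any.Properties using (reverseAcc⁺; reverseAcc⁻)
open import Data.List.Relation.Unary.All using (All; []; _∷_)
import Data.List.Relation.Unary.All as All
open import Data.List.Relation.Unary.AllPairs using ([]; _∷_)
import Data.List.Relation.Unary.AllPairs as AllPairs
open import Data.List.Relation.Unary.Linked using (Linked; []; [-]; _∷_)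
import Data.List.Relation.Unary.Linked as Linked
open import Data.List.Relation.Unary.Linked.Properties using (Linked⇒AllPairs)
open import Data.List.Relation.Unary.Unique.Propositional using (Unique)
import Data.List.Relation.Unary.Unique.Propositional.Properties as Unique
open import Data.List.Relation.Binary.Sublist.Propositional
  using (_⊆_; []; _∷_; _∷ʳ_; ⊆-refl; ⊆-trans; lookup; minimum; from∈)
open import Data.List.Relation.Binary.Sublist.Propositional.Properties
  using (All-resp-⊆; reverse⁺; ʳ++⁺; length-mono-≤)
open import Data.List.Relation.Binary.Permutation.Propositional using (_↭_; prep; ↭-sym; ↭-trans; ↭⇒↭ₛ)
open import Data.List.Relation.Binary.Permutation.Propositional.Properties using (∈-resp-↭; shift; ++↭ʳ++)
import Data.List.Relation.Binary.Permutation.Setoid.Properties as Permutationₛ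
open import Data.Product using (_×_; _,_; proj₁; proj₂; ∃-syntax; ∃₂; uncurry)
open import Data.Sum using (_⊎_; inj₁; inj₂; swap)
import Data.Sum as Sum
open import Data.Empty using (⊥-elim)
open import Function using (_∘_)
open import Function.Bundles using (_⇔_; mk⇔)
open import Relation.Nullary using (yes; no)
open import Relation.Binary.PropositionalEquality
  using (_≡_; _≢_; refl; sym; trans; cong; subst; setoid)
open import Relation.Binary.Definitions using (tri<; tri≈; tri>)

private
  variable
    A : Set
    v : A
    xs ys zs : List A

Unique-resp-⊆ : xs ⊆ ys → Unique ys → Unique xs
Unique-resp-⊆ []         _           = []
Unique-resp-⊆ (_ ∷ʳ p)   (_ ∷ u)     = Unique-resp-⊆ p u
Unique-resp-⊆ (refl ∷ p) (x≢ys ∷ u) = All-resp-⊆ p x≢ys ∷ Unique-resp-⊆ p u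

Unique-resp-↭ : {A : Set} {xs ys : List A} → xs ↭ ys → Unique xs → Unique ys
Unique-resp-↭ {A} p = Permutationₛ.Unique-resp-↭ (setoid A) (↭⇒↭ₛ p)

∈-ʳ++⁺ˡ : v ∈ xs → v ∈ xs ʳ++ ys
∈-ʳ++⁺ˡ {xs = xs} {ys = ys} v∈xs = reverseAcc⁺ ys xs (inj₂ v∈xs)

∈-ʳ++⁻ : ∀ xs → v ∈ xs ʳ++ ys → v ∈ xs ⊎ v ∈ ys
∈-ʳ++⁻ {ys = ys} xs v∈ = swap (reverseAcc⁻ ys xs v∈)

⊆-ʳ++ : ∀ xs → ys ⊆ xs ʳ++ ys
⊆-ʳ++ {ys = ys} xs = ʳ++⁺ (minimum xs) (⊆-refl {x = ys})

ʳ++-shift : ∀ (xs : List A) {y ys} → xs ʳ++ y ∷ ys ↭ y ∷ xs ʳ++ ys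
ʳ++-shift xs {y} {ys} =
  ↭-trans (↭-sym (++↭ʳ++ xs (y ∷ ys))) (↭-trans (shift y xs ys) (prep y (++↭ʳ++ xs ys)))

⊆-middle⁻ : ∀ (xs : List A) {y} → zs ⊆ xs ++ y ∷ ys →
            zs ⊆ xs ++ ys ⊎
            ∃₂ λ zs₁ zs₂ → zs ≡ zs₁ ++ y ∷ zs₂ × zs₁ ⊆ xs × zs₂ ⊆ ys
⊆-middle⁻ []       (_ ∷ʳ p)   = inj₁ p
⊆-middle⁻ []       (refl ∷ p) = inj₂ ([] , _ , refl , [] , p)
⊆-middle⁻ (x ∷ xs) (_ ∷ʳ p)   with ⊆-middle⁻ xs p
... | inj₁ q                          = inj₁ (x ∷ʳ q)
... | inj₂ (zs₁ , zs₂ , eq , q₁ , q₂) = inj₂ (zs₁ , zs₂ , eq , x ∷ʳ q₁ , q₂)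
⊆-middle⁻ (x ∷ xs) (refl ∷ p) with ⊆-middle⁻ xs p
... | inj₁ q                            = inj₁ (refl ∷ q)
... | inj₂ (zs₁ , zs₂ , refl , q₁ , q₂) = inj₂ (x ∷ zs₁ , zs₂ , refl , refl ∷ q₁ , q₂)

Linked-<-head : ∀ {y t} → Linked _<_ (y ∷ t) → v ∈ t → y < v
Linked-<-head sorted = All.lookup (AllPairs.head (Linked⇒AllPairs <-trans sorted))

popAll-invariant : (P : ℕ → List ℕ → Set) → (∀ {m s} → P m (m ∷ s) → P (suc m) s) →
                   ∀ {m} s → P m s → uncurry P (popAll m s)
popAll-invariant P pop []      p = p
popAll-invariant P pop {m} (y ∷ s) p with y ≟ m
... | yes refl = popAll-invariant P pop s (pop p)
... | no  _    = p

popAll-head≢ : ∀ m s → head (proj₂ (popAll m s)) ≢ just (proj₁ (popAll m s))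
popAll-head≢ m []      ()
popAll-head≢ m (y ∷ s) with y ≟ m
... | yes refl = popAll-head≢ (suc y) s
... | no  y≢m  = y≢m ∘ just-injective

passFrom-invariant :
  (P : ℕ → List ℕ → List ℕ → Set) →
  (∀ {m x xs s} → P m s (x ∷ xs) → uncurry (λ m′ s′ → P m′ s′ xs) (popAll m (x ∷ s))) →
  ∀ {m} xs {s} → P m s xs → ∃₂ λ m′ s′ → P m′ s′ [] × passFrom m xs s ≡ (m′ , reverse s′)
passFrom-invariant P step {m} []       {s} p = m , s , p , refl
passFrom-invariant P step {m} (x ∷ xs) {s} p with popAll m (x ∷ s) | step p
... | m′ , s′ | p′ = passFrom-invariant P step xs p′

passesWith-[] : ∀ f m → passesWith f m [] ≡ 0
passesWith-[] zero    m = refl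
passesWith-[] (suc f) m = refl

pass-empties⇒tier≡0 : ∀ π → proj₂ (pass 1 π) ≡ [] → tier π ≡ 0
pass-empties⇒tier≡0 []       _       = refl
pass-empties⇒tier≡0 (x ∷ xs) empties with pass 1 (x ∷ xs)
... | m , rest = trans (cong (passesWith (length xs) m) empties) (passesWith-[] (length xs) m)

pass-leaves⇒0<tier : ∀ π → 2 ≤ length π → v ∈ proj₂ (pass 1 π) → 0 < tier π
pass-leaves⇒0<tier (x ∷ x′ ∷ xs) _ v∈rest with pass 1 (x ∷ x′ ∷ xs)
... | m , _ ∷ _ = s≤s z≤n
pass-leaves⇒0<tier (x ∷ []) (s≤s ()) _

Separated : List ℕ → Set
Separated L = ∃[ i ] ∃[ k ] suc i < k × (suc i ∷ k ∷ i ∷ []) ⊆ L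

-- The stack is listed from its top, so this is an entry lying above a smaller one.
Inverted : List ℕ → Set
Inverted s = ∃[ a ] ∃[ b ] b < a × (a ∷ b ∷ []) ⊆ s

Separated-pop : ∀ t {m xs} → (∀ {v} → v ∈ t ʳ++ m ∷ xs → m ≤ v) →
                Separated (t ʳ++ m ∷ xs) → Separated (t ʳ++ xs) ⊎ Inverted t
Separated-pop t {m} {xs} lower (i , k , i+1<k , p)
  rewrite ʳ++-defn t {m ∷ xs} | ʳ++-defn t {xs}
  with ⊆-middle⁻ (reverse t) p
... | inj₁ p′ = inj₁ (i , k , i+1<k , p′)
... | inj₂ ([] , _ , refl , _ , _) =
  ⊥-elim (1+n≰n (lower (lookup p (there (there (here refl))))))
... | inj₂ (_ ∷ [] , _ , refl , _ , _) =
  ⊥-elim (<⇒≱ (<-trans (n<1+n i) i+1<k) (lower (lookup p (there (there (here refl))))))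
... | inj₂ (_ ∷ _ ∷ [] , [] , refl , ascending , _) =
  inj₂ (k , suc i , i+1<k , subst ((k ∷ suc i ∷ []) ⊆_) (reverse-involutive t) (reverse⁺ ascending))
... | inj₂ (_ ∷ _ ∷ [] , _ ∷ _ , () , _ , _)
... | inj₂ (_ ∷ _ ∷ _ ∷ [] , _ , () , _ , _)
... | inj₂ (_ ∷ _ ∷ _ ∷ _ ∷ _ , _ , () , _ , _)

Inverted-pop : ∀ {m t} → (∀ {v} → v ∈ t → m ≤ v) → Inverted (m ∷ t) → Inverted t
Inverted-pop _     (a , b , b<a , (_ ∷ʳ p))   = a , b , b<a , p
Inverted-pop lower (a , b , b<a , (refl ∷ p)) = ⊥-elim (<⇒≱ b<a (lower (lookup p (here refl))))

module _ {n π} (perm : IsPermutation n π) where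

  IsPermutation⇒Unique : Unique π
  IsPermutation⇒Unique =
    Unique-resp-↭ (↭-sym perm) (Unique.map⁺ suc-injective (Unique.upTo⁺ n))

  ∈-IsPermutation⁻ : ∀ {v} → v ∈ π → 1 ≤ v × v ≤ n
  ∈-IsPermutation⁻ v∈π with ∈-map⁻ suc (∈-resp-↭ perm v∈π)
  ... | _ , u∈ , refl = s≤s z≤n , ∈-upTo⁻ u∈

  ∈-IsPermutation⁺ : ∀ {v} → 1 ≤ v → v ≤ n → v ∈ π
  ∈-IsPermutation⁺ {suc u} _ v≤n = ∈-resp-↭ (↭-sym perm) (∈-map⁺ suc (∈-upTo⁺ v≤n))

  -- A stack is listed from its top, so s ʳ++ xs is the stack from bottom to
  -- top followed by the input xs.
  record Remaining (m : ℕ) (L : List ℕ) : Set where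
    field
      ⊆π       : L ⊆ π
      lower    : ∀ {v} → v ∈ L → m ≤ v
      complete : ∀ {v} → v ∈ π → m ≤ v → v ∈ L
      1≤m      : 1 ≤ m

    unique : Unique L
    unique = Unique-resp-⊆ ⊆π IsPermutation⇒Unique

  open Remaining

  Remaining-start : Remaining 1 π
  Remaining-start = record
    { ⊆π = ⊆-refl ; lower = proj₁ ∘ ∈-IsPermutation⁻ ; complete = λ v∈π _ → v∈π ; 1≤m = ≤-refl }

  Remaining-pop : ∀ t {m xs} → Remaining m (t ʳ++ m ∷ xs) → Remaining (suc m) (t ʳ++ xs)
  Remaining-pop t {m} {xs} r = record
    { ⊆π       = ⊆-trans (ʳ++⁺ (⊆-refl {x = t}) (m ∷ʳ ⊆-refl)) (⊆π r)
    ; lower    = λ v∈ → ≤∧≢⇒< (lower r (∈-resp-↭ (↭-sym shifted) (there v∈))) (All.lookup m∉ v∈)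
    ; complete = λ v∈π m<v → remove (complete r v∈π (<⇒≤ m<v)) (>⇒≢ m<v)
    ; 1≤m      = ≤-trans (1≤m r) (n≤1+n m)
    }
    where
      shifted : t ʳ++ m ∷ xs ↭ m ∷ t ʳ++ xs
      shifted = ʳ++-shift t
      m∉ : All (m ≢_) (t ʳ++ xs)
      m∉ = AllPairs.head (Unique-resp-↭ shifted (unique r))
      remove : ∀ {v} → v ∈ t ʳ++ m ∷ xs → v ≢ m → v ∈ t ʳ++ xs
      remove v∈ v≢m with ∈-resp-↭ shifted v∈
      ... | here v≡m = ⊥-elim (v≢m v≡m)
      ... | there v∈′ = v∈′

  SortedStack : ℕ → List ℕ → List ℕ → Set
  SortedStack m s xs = Remaining m (s ʳ++ xs) × Linked _<_ s × head s ≢ just m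

  separatedPair-below-top : ∀ {m y x t xs} → Remaining m (t ʳ++ y ∷ x ∷ xs) →
                            Linked _<_ (y ∷ t) → m < y → y < x → HasSeparatedPair n π
  separatedPair-below-top {y = suc i} {x} {t} {xs} r sorted (s≤s m≤i) i+1<x =
    i , 1≤i , ∸-monoˡ-≤ 1 i+1≤n , x , i+1<x , ⊆-trans (⊆-trans triple (⊆-ʳ++ t)) (⊆π r)
    where
      1≤i : 1 ≤ i
      1≤i = ≤-trans (1≤m r) m≤i
      i+1≤n : suc i ≤ n
      i+1≤n = proj₂ (∈-IsPermutation⁻ (lookup (⊆π r) (lookup (⊆-ʳ++ t) (here refl))))
      i∈xs : i ∈ xs
      i∈xs with ∈-ʳ++⁻ t (complete r (∈-IsPermutation⁺ 1≤i (<⇒≤ i+1≤n)) m≤i)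
      ... | inj₁ i∈t                  = ⊥-elim (<⇒≱ (Linked-<-head sorted i∈t) (n≤1+n i))
      ... | inj₂ (here i≡i+1)         = ⊥-elim (1+n≢n (sym i≡i+1))
      ... | inj₂ (there (here i≡x))   = ⊥-elim (<⇒≢ (<-trans (n<1+n i) i+1<x) i≡x)
      ... | inj₂ (there (there i∈xs)) = i∈xs
      triple : (suc i ∷ x ∷ i ∷ []) ⊆ suc i ∷ x ∷ xs
      triple = refl ∷ refl ∷ from∈ i∈xs

  push-sorted : ∀ {m x xs} s → SortedStack m s (x ∷ xs) →
                HasSeparatedPair n π ⊎ Linked _<_ (x ∷ s)
  push-sorted []      _ = inj₂ [-]
  push-sorted {m} {x} {xs} (y ∷ t) (r , sorted , top≢m) with <-cmp x y
  ... | tri< x<y _ _ = inj₂ (x<y ∷ sorted)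
  ... | tri≈ _ refl _ with Unique-resp-⊆ (⊆-trans (refl ∷ refl ∷ minimum xs) (⊆-ʳ++ t)) (unique r)
  ...   | (x≢x ∷ _) ∷ _ = ⊥-elim (x≢x refl)
  push-sorted {m} {x} {xs} (y ∷ t) (r , sorted , top≢m) | tri> _ _ y<x =
    inj₁ (separatedPair-below-top r sorted m<y y<x)
    where
      m<y : m < y
      m<y = ≤∧≢⇒< (lower r (lookup (⊆-ʳ++ t) (here refl))) (top≢m ∘ cong just ∘ sym)

  step-sorted : ∀ {m x xs s} → HasSeparatedPair n π ⊎ SortedStack m s (x ∷ xs) →
                HasSeparatedPair n π ⊎ uncurry (λ m′ s′ → SortedStack m′ s′ xs) (popAll m (x ∷ s))
  step-sorted (inj₁ sep) = inj₁ sep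
  step-sorted {m} {x} {xs} {s} (inj₂ st@(r , _ , _)) with push-sorted s st
  ... | inj₁ sep    = inj₁ sep
  ... | inj₂ sorted =
    let r′ , sorted′ = popAll-invariant (λ m s → Remaining m (s ʳ++ xs) × Linked _<_ s)
                         (λ {_} {t} (r , sorted) → Remaining-pop t r , Linked.tail sorted)
                         (x ∷ s) (r , sorted)
    in inj₂ (r′ , sorted′ , popAll-head≢ m (x ∷ s))

  SortedStack-end : ∀ {m} s → SortedStack m s [] → s ≡ []
  SortedStack-end []      _                    = refl
  SortedStack-end {m} (y ∷ t) (r , sorted , top≢m) = ⊥-elim (top≢m (cong just (≤-antisym y≤m m≤y)))
    where
      y∈ : y ∈ (y ∷ t) ʳ++ []
      y∈ = ∈-ʳ++⁺ˡ {xs = y ∷ t} (here refl)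
      m≤y : m ≤ y
      m≤y = lower r y∈
      y≤m : y ≤ m
      y≤m with ∈-ʳ++⁻ (y ∷ t) (complete r (∈-IsPermutation⁺ (1≤m r)
                 (≤-trans m≤y (proj₂ (∈-IsPermutation⁻ (lookup (⊆π r) y∈))))) ≤-refl)
      ... | inj₁ (here m≡y)  = ≤-reflexive (sym m≡y)
      ... | inj₁ (there m∈t) = <⇒≤ (Linked-<-head sorted m∈t)

  pass-sorts-or-separatedPair : proj₂ (pass 1 π) ≡ [] ⊎ HasSeparatedPair n π
  pass-sorts-or-separatedPair
    with passFrom-invariant (λ m s xs → HasSeparatedPair n π ⊎ SortedStack m s xs) step-sorted π
           (inj₂ (Remaining-start , [] , λ ()))
  ... | _ , _ , inj₁ sep , _  = inj₂ sep
  ... | _ , s , inj₂ st , eq = inj₁ (trans (cong proj₂ eq) (cong reverse (SortedStack-end s st)))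

  Obstructed : ℕ → List ℕ → List ℕ → Set
  Obstructed m s xs = Remaining m (s ʳ++ xs) × (Separated (s ʳ++ xs) ⊎ Inverted s)

  pop-obstructed : ∀ {m t xs} → Obstructed m (m ∷ t) xs → Obstructed (suc m) t xs
  pop-obstructed {t = t} (r , inj₁ sep) = Remaining-pop t r , Separated-pop t (lower r) sep
  pop-obstructed {t = t} (r , inj₂ inv) =
    Remaining-pop t r , inj₂ (Inverted-pop (lower r ∘ ∈-ʳ++⁺ˡ {xs = t}) inv)

  step-obstructed : ∀ {m x xs s} → Obstructed m s (x ∷ xs) →
                    uncurry (λ m′ s′ → Obstructed m′ s′ xs) (popAll m (x ∷ s))
  step-obstructed {x = x} {xs} {s} (r , o) =
    popAll-invariant (λ m s → Obstructed m s xs) pop-obstructed (x ∷ s)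
      (r , Sum.map₂ (λ (a , b , b<a , p) → a , b , b<a , x ∷ʳ p) o)

  Obstructed-end : ∀ {m} s → Obstructed m s [] → ∃[ v ] v ∈ s
  Obstructed-end s (_ , inj₁ (i , _ , _ , p)) with ∈-ʳ++⁻ s (lookup p (there (there (here refl))))
  ... | inj₁ i∈s = i , i∈s
  Obstructed-end s (_ , inj₂ (a , _ , _ , p)) = a , lookup p (here refl)

  separatedPair⇒pass-leaves : Separated π → ∃[ v ] v ∈ proj₂ (pass 1 π)
  separatedPair⇒pass-leaves sep
    with passFrom-invariant Obstructed step-obstructed π (Remaining-start , inj₁ sep)
  ... | _ , s , o , eq with Obstructed-end s o
  ...   | v , v∈s = v , subst (v ∈_) (sym (cong proj₂ eq)) (∈-ʳ++⁺ˡ v∈s)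

proposition2p3 : (n : ℕ) (π : List ℕ) → IsPermutation n π →
                 (0 < tier π) ⇔ HasSeparatedPair n π
proposition2p3 n π perm = mk⇔ to from
  where
    to : 0 < tier π → HasSeparatedPair n π
    to 0<tier with pass-sorts-or-separatedPair perm
    ... | inj₁ empties = ⊥-elim (<⇒≢ 0<tier (sym (pass-empties⇒tier≡0 π empties)))
    ... | inj₂ sep     = sep
    from : HasSeparatedPair n π → 0 < tier π
    from (i , _ , _ , k , i+1<k , p) with separatedPair⇒pass-leaves perm (i , k , i+1<k , p)
    ... | _ , v∈rest = pass-leaves⇒0<tier π (<⇒≤ (length-mono-≤ p)) v∈rest
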